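{- Let $S$ be a string of length $n$, let $m=|\mathcal{M}_S|$ and write $\mathcal{M}_S=\{[b_1,e_1],\dots,[b_m,e_m]\}$ with $b_1<\dots<b_m$. For any position $u$ with $1 \leq u \leq b_1$ or $b_m < u \leq n$, we have $|f^{ -1}(u)| \leq 1$.
   Context: For a string $S$ of length $n$ and $1 \le i \le j \le n$, $S[i..j]$ is the substring from position $i$ to position $j$; a non-empty substring is unique if it occurs exactly once in $S$ and repeating if it occurs at least twice; an interval $[i,j]$ is unique/repeating according to $S[i..j]$. An interval $[i,j]$ is a minimal unique substring (MUS) if $S[i..j]$ is unique and every proper substring $S[i'..j']$ ($i\le i'$, $j'\le j$, $j'-i'<j-i$) is repeating; $\mathcal{M}_S$ is the set of all MUS intervals (no two MUSs share a beginning position). $[s,t]\subset[i,j]$ means $i\le s$ and $t\le j$. An interval $[i,j]$ is a shortest unique substring (SUS) for $[s,t]$ if $S[i..j]$ is unique, $[s,t]\subset[i,j]$, and $S[i'..j']$ is repeating for every $[i',j']\supset[s,t]$ with $j'-i'<j-i$. $\mathsf{SUS}_S(p)$ is the set of SUSs for $[p,p]$ and $\mathcal{PS}_S=\bigcup_{p=1}^n\mathsf{SUS}_S(p)$. Let $\mathcal{LS}_S=\mathcal{PS}_S\cap\{[x,y]\notin\mathcal{M}_S : \exists i,\ x<i\le y,\ [i,y]\in\mathcal{M}_S\}$, $\mathcal{MS}_S=\mathcal{PS}_S\cap\mathcal{M}_S$, and $\mathcal{RS}_S=\mathcal{PS}_S\cap\{[x,y]\notin\mathcal{M}_S : \exists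 j,\ x\le j<y,\ [x,j]\in\mathcal{M}_S\}$; these three sets are pairwise disjoint and their union is $\mathcal{PS}_S$. Define $f:\mathcal{PS}_S\to\{1,\dots,n\}$ by $f([x,y])=x$ if $[x,y]\in\mathcal{LS}_S\cup\mathcal{MS}_S$ and $f([x,y])=y$ if $[x,y]\in\mathcal{RS}_S$, and $f^{ -1}(u)=\{[x,y]\in\mathcal{PS}_S : f([x,y])=u\}$. -}

module Defs where

open import Data.Nat using (ℕ; zero; suc; _+_; _∸_; _≤_; _<_)
open import Data.List using (List; []; _∷_; length)
open import Data.Maybe using (Maybe; just; nothing)
open import Data.Product using (_×_; _,_; ∃; ∃-syntax)
open import Data.Sum using (_⊎_)
open import Relation.Binary.PropositionalEquality using (_≡_; _≢_)
open import Relation.Nullary using (¬_)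

-- Intervals [i , j] are pairs of natural numbers; positions are 1-indexed.
Interval : Set
Interval = ℕ × ℕ

module _ {A : Set} where

  at : List A → ℕ → Maybe A
  at []       _             = nothing
  at (x ∷ xs) zero          = nothing
  at (x ∷ xs) (suc zero)    = just x
  at (x ∷ xs) (suc (suc k)) = at xs (suc k)

  Valid : List A → ℕ → ℕ → Set
  Valid S i j = 1 ≤ i × i ≤ j × j ≤ length S

  OccursAt : List A → ℕ → ℕ → ℕ → Set
  OccursAt S i j k =
    1 ≤ k × k + (j ∸ i) ≤ length S ×
    (∀ d → d ≤ j ∸ i → at S (i + d) ≡ at S (k + d))

  IsUnique : List A → ℕ → ℕ → Set
  IsUnique S i j = Valid S i j × (∀ k → OccursAt S i j k → k ≡ i)

  IsRepeating : List A → ℕ → ℕ → Set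
  IsRepeating S i j = Valid S i j × ∃[ k ] (k ≢ i × OccursAt S i j k)

  MUS : List A → ℕ → ℕ → Set
  MUS S i j =
    IsUnique S i j ×
    (∀ i' j' → i ≤ i' → i' ≤ j' → j' ≤ j → j' ∸ i' < j ∸ i → IsRepeating S i' j')

  SUS : List A → (s t i j : ℕ) → Set
  SUS S s t i j =
    IsUnique S i j × i ≤ s × t ≤ j ×
    (∀ i' j' → Valid S i' j' → i' ≤ s → t ≤ j' → j' ∸ i' < j ∸ i → IsRepeating S i' j')

  PS : List A → ℕ → ℕ → Set
  PS S x y = ∃[ p ] (1 ≤ p × p ≤ length S × SUS S p p x y)

  LS : List A → ℕ → ℕ → Set
  LS S x y = PS S x y × ¬ MUS S x y × ∃[ i ] (x < i × i ≤ y × MUS S i y)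

  MS : List A → ℕ → ℕ → Set
  MS S x y = PS S x y × MUS S x y

  RS : List A → ℕ → ℕ → Set
  RS S x y = PS S x y × ¬ MUS S x y × ∃[ j ] (x ≤ j × j < y × MUS S x j)

  -- f([x,y]) = u, as a relation (LS, MS, RS partition PS, so this is the graph of f)
  FMapsTo : List A → Interval → ℕ → Set
  FMapsTo S (x , y) u = ((LS S x y ⊎ MS S x y) × u ≡ x) ⊎ (RS S x y × u ≡ y)

  InPreimage : List A → ℕ → Interval → Set
  InPreimage S u (x , y) = PS S x y × FMapsTo S (x , y) u

-- Left of the first MUS (u ≤ every MUS beginning) no interval of f⁻¹(u) lies in RS, so f⁻¹(u)
-- consists of SUSs starting at u, each either a MUS or having a MUS as a proper suffix.  If two
-- of them [u,y] and [u,y'] had y < y', the shorter one would be a unique proper prefix of the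
-- longer one, which is impossible for a MUS; otherwise the longer one is a SUS for some q, and
-- minimality forces q = y' (else [u, max y q] is a shorter unique interval covering q), so the
-- MUS suffix of [u,y'] covers q and is shorter.  Right of the last MUS the situation is mirrored:
-- f⁻¹(u) ⊆ RS consists of SUSs ending at u with a MUS proper prefix.
module Submission where

open import Defs
open import Data.Nat using (ℕ; _≤_; _<_; _+_; _∸_)
open import Data.Nat.Properties
open import Data.List using (List; length)
open import Data.Sum using (_⊎_; inj₁; inj₂)
open import Data.Product using (_,_; _×_; proj₁)
open import Data.Empty using (⊥; ⊥-elim)
open import Relation.Binary using (tri<; tri≈; tri>)
open import Relation.Binary.PropositionalEquality

[n∸m]+[o∸n]≡o∸m : ∀ {m n o} → m ≤ n → n ≤ o → (n ∸ m) + (o ∸ n) ≡ o ∸ m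
[n∸m]+[o∸n]≡o∸m {m} {n} {o} m≤n n≤o = +-cancelˡ-≡ m _ _ (begin
  m + ((n ∸ m) + (o ∸ n)) ≡⟨ sym (+-assoc m (n ∸ m) (o ∸ n)) ⟩
  (m + (n ∸ m)) + (o ∸ n) ≡⟨ cong (_+ (o ∸ n)) (m+[n∸m]≡n m≤n) ⟩
  n + (o ∸ n)             ≡⟨ m+[n∸m]≡n n≤o ⟩
  o                       ≡⟨ sym (m+[n∸m]≡n (≤-trans m≤n n≤o)) ⟩
  m + (o ∸ m)             ∎)
  where open ≡-Reasoning

module _ {A : Set} (S : List A) where

  OccursAt-prefix : ∀ {i j j' k} → j ≤ j' → OccursAt S i j' k → OccursAt S i j k
  OccursAt-prefix {i} {k = k} j≤j' (1≤k , fits , agree) =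
    1≤k , ≤-trans (+-monoʳ-≤ k shorter) fits , λ d d≤ → agree d (≤-trans d≤ shorter)
    where shorter = ∸-monoˡ-≤ i j≤j'

  OccursAt-suffix : ∀ {i' i j k} → i' ≤ i → i ≤ j →
                    OccursAt S i' j k → OccursAt S i j (k + (i ∸ i'))
  OccursAt-suffix {i'} {i} {j} {k} i'≤i i≤j (1≤k , fits , agree) =
    ≤-trans 1≤k (m≤m+n k c) , fits′ , agree′
    where
    open ≡-Reasoning
    c = i ∸ i'
    split : c + (j ∸ i) ≡ j ∸ i'
    split = [n∸m]+[o∸n]≡o∸m i'≤i i≤j
    fits′ : (k + c) + (j ∸ i) ≤ length S
    fits′ = subst (_≤ length S) (trans (cong (k +_) (sym split)) (sym (+-assoc k c _))) fits
    agree′ : ∀ d → d ≤ j ∸ i → at S (i + d) ≡ at S ((k + c) + d)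
    agree′ d d≤ = begin
      at S (i + d)         ≡⟨ cong (λ z → at S (z + d)) (sym (m+[n∸m]≡n i'≤i)) ⟩
      at S ((i' + c) + d)  ≡⟨ cong (at S) (+-assoc i' c d) ⟩
      at S (i' + (c + d))  ≡⟨ agree (c + d) (subst (c + d ≤_) split (+-monoʳ-≤ c d≤)) ⟩
      at S (k + (c + d))   ≡⟨ cong (at S) (sym (+-assoc k c d)) ⟩
      at S ((k + c) + d)   ∎

  IsUnique-extendʳ : ∀ {i j j'} → j ≤ j' → j' ≤ length S → IsUnique S i j → IsUnique S i j'
  IsUnique-extendʳ j≤j' j'≤n ((1≤i , i≤j , _) , once) =
    (1≤i , ≤-trans i≤j j≤j' , j'≤n) , λ k occ → once k (OccursAt-prefix j≤j' occ)

  IsUnique-extendˡ : ∀ {i' i j} → 1 ≤ i' → i' ≤ i → IsUnique S i j → IsUnique S i' j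
  IsUnique-extendˡ {i'} {i} 1≤i' i'≤i ((_ , i≤j , j≤n) , once) =
    (1≤i' , ≤-trans i'≤i i≤j , j≤n) , λ k occ →
      +-cancelʳ-≡ (i ∸ i') k i'
        (trans (once _ (OccursAt-suffix i'≤i i≤j occ)) (sym (m+[n∸m]≡n i'≤i)))

  unique⇒¬repeating : ∀ {i j} → IsUnique S i j → IsRepeating S i j → ⊥
  unique⇒¬repeating (_ , once) (_ , k , k≢i , occ) = k≢i (once k occ)

  MUS-minimal : ∀ {x y i j} → MUS S x y → IsUnique S i j →
                x ≤ i → j ≤ y → j ∸ i < y ∸ x → ⊥
  MUS-minimal (_ , inner) uniq@((_ , i≤j , _) , _) x≤i j≤y shorter =
    unique⇒¬repeating uniq (inner _ _ x≤i i≤j j≤y shorter)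

  SUS-minimal : ∀ {q x y i j} → SUS S q q x y → IsUnique S i j →
                i ≤ q → q ≤ j → j ∸ i < y ∸ x → ⊥
  SUS-minimal (_ , _ , _ , covering) uniq i≤q q≤j shorter =
    unique⇒¬repeating uniq (covering _ _ (proj₁ uniq) i≤q q≤j shorter)

  SUS-point-at-end : ∀ {q x y y'} → SUS S q q x y' → IsUnique S x y → y < y' → q ≡ y'
  SUS-point-at-end {q} {y = y} sus@(((_ , _ , y'≤n) , _) , x≤q , q≤y' , _)
                   uniq@((_ , x≤y , _) , _) y<y'
    with ≤-<-connex q y
  ... | inj₁ q≤y = ⊥-elim (SUS-minimal sus uniq x≤q q≤y (∸-monoˡ-< y<y' x≤y))
  ... | inj₂ y<q with m≤n⇒m<n∨m≡n q≤y'
  ...   | inj₁ q<y' = ⊥-elim (SUS-minimal sus (IsUnique-extendʳ (<⇒≤ y<q) (≤-trans q≤y' y'≤n) uniq)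
                                x≤q ≤-refl (∸-monoˡ-< q<y' x≤q))
  ...   | inj₂ q≡y' = q≡y'

  SUS-point-at-start : ∀ {q x x' y} → SUS S q q x y → IsUnique S x' y → x < x' → q ≡ x
  SUS-point-at-start {q} {x' = x'} sus@(((1≤x , _) , _) , x≤q , q≤y , _)
                     uniq@((_ , x'≤y , _) , _) x<x'
    with ≤-<-connex x' q
  ... | inj₁ x'≤q = ⊥-elim (SUS-minimal sus uniq x'≤q q≤y (∸-monoʳ-< x<x' x'≤y))
  ... | inj₂ q<x' with m≤n⇒m<n∨m≡n x≤q
  ...   | inj₁ x<q = ⊥-elim (SUS-minimal sus (IsUnique-extendˡ (≤-trans 1≤x x≤q) (<⇒≤ q<x') uniq)
                               ≤-refl q≤y (∸-monoʳ-< x<q q≤y))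
  ...   | inj₂ x≡q = sym x≡q

  LS∪MS-no-unique-proper-prefix : ∀ {x y y'} → LS S x y' ⊎ MS S x y' →
                                  IsUnique S x y → y < y' → ⊥
  LS∪MS-no-unique-proper-prefix (inj₂ (_ , mus)) uniq@((_ , x≤y , _) , _) y<y' =
    MUS-minimal mus uniq ≤-refl (<⇒≤ y<y') (∸-monoˡ-< y<y' x≤y)
  LS∪MS-no-unique-proper-prefix (inj₁ ((q , _ , _ , sus) , _ , i , x<i , i≤y' , mus)) uniq y<y'
    with SUS-point-at-end sus uniq y<y'
  ... | refl = SUS-minimal sus (proj₁ mus) i≤y' ≤-refl (∸-monoʳ-< x<i i≤y')

  RS-no-unique-proper-suffix : ∀ {x x' y} → RS S x y → IsUnique S x' y → x < x' → ⊥
  RS-no-unique-proper-suffix ((q , _ , _ , sus) , _ , j , x≤j , j<y , mus) uniq x<x'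
    with SUS-point-at-start sus uniq x<x'
  ... | refl = SUS-minimal sus (proj₁ mus) ≤-refl x≤j (∸-monoˡ-< j<y x≤j)

  PS⇒unique : ∀ {x y} → PS S x y → IsUnique S x y
  PS⇒unique (_ , _ , _ , uniq , _) = uniq

  LS∪MS-same-start⇒same-end : ∀ {x y y'} → LS S x y ⊎ MS S x y → LS S x y' ⊎ MS S x y' →
                              PS S x y → PS S x y' → y ≡ y'
  LS∪MS-same-start⇒same-end {y = y} {y'} I J ps ps' with <-cmp y y'
  ... | tri< y<y' _ _ = ⊥-elim (LS∪MS-no-unique-proper-prefix J (PS⇒unique ps) y<y')
  ... | tri≈ _ y≡y' _ = y≡y'
  ... | tri> _ _ y'<y = ⊥-elim (LS∪MS-no-unique-proper-prefix I (PS⇒unique ps') y'<y)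

  RS-same-end⇒same-start : ∀ {x x' y} → RS S x y → RS S x' y → x ≡ x'
  RS-same-end⇒same-start {x} {x'} I J with <-cmp x x'
  ... | tri< x<x' _ _ = ⊥-elim (RS-no-unique-proper-suffix I (PS⇒unique (proj₁ J)) x<x')
  ... | tri≈ _ x≡x' _ = x≡x'
  ... | tri> _ _ x'<x = ⊥-elim (RS-no-unique-proper-suffix J (PS⇒unique (proj₁ I)) x'<x)

  preimage-before-first-MUS : ∀ {u x y} → (∀ b e → MUS S b e → u ≤ b) →
                              InPreimage S u (x , y) → x ≡ u × (LS S x y ⊎ MS S x y)
  preimage-before-first-MUS _ (_ , inj₁ (I , u≡x)) = sym u≡x , I
  preimage-before-first-MUS before (_ , inj₂ ((_ , _ , j , x≤j , j<y , mus) , refl)) =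
    ⊥-elim (<-irrefl refl (≤-<-trans (before _ j mus) (≤-<-trans x≤j j<y)))

  preimage-after-last-MUS : ∀ {u x y} → (∀ b e → MUS S b e → b < u) →
                            InPreimage S u (x , y) → y ≡ u × RS S x y
  preimage-after-last-MUS after (_ , inj₁ (inj₁ (_ , _ , i , x<i , _ , mus) , refl)) =
    ⊥-elim (<-asym x<i (after i _ mus))
  preimage-after-last-MUS after (_ , inj₁ (inj₂ (_ , mus) , refl)) =
    ⊥-elim (<-irrefl refl (after _ _ mus))
  preimage-after-last-MUS _ (_ , inj₂ (I , u≡y)) = sym u≡y , I

lemma5 : {A : Set} (S : List A) (u : ℕ) →
         1 ≤ u → u ≤ length S →
         ((∀ b e → MUS S b e → u ≤ b) ⊎ (∀ b e → MUS S b e → b < u)) →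
         (I J : Interval) → InPreimage S u I → InPreimage S u J → I ≡ J
lemma5 S u _ _ (inj₁ before) (x , y) (x' , y') pI pJ
  with preimage-before-first-MUS S before pI | preimage-before-first-MUS S before pJ
... | refl , I | refl , J = cong (x ,_) (LS∪MS-same-start⇒same-end S I J (proj₁ pI) (proj₁ pJ))
lemma5 S u _ _ (inj₂ after) (x , y) (x' , y') pI pJ
  with preimage-after-last-MUS S after pI | preimage-after-last-MUS S after pJ
... | refl , I | refl , J = cong (_, y) (RS-same-end⇒same-start S I J)
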